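{- Let $\ell\geq 2$ be an integer, let $G$ be a graph with girth exactly $2\ell$ and no even hole of length at least $2\ell+2$, and let $C$ be an even hole of $G$. For $i=1,2$ let $P_i$ be a $(u_i,v_i)$-jump over $C$ which is either short and of type-o, or local across one vertex, where $\{u_1,v_1\}\neq\{u_2,v_2\}$. Assume $P_1,P_2$ are parallel and internally disjoint. Then some internal vertex of $P_1$ is equal or adjacent to... more precisely, the sets of internal vertices $P_1^*$ and $P_2^*$ are not anti-complete (some edge of $G$ joins a vertex of $P_1^*$ to a vertex of $P_2^*$).
   Context: A hole is an induced cycle of length at least four; even/odd refers to length parity. For a hole $C$ and non-adjacent $s,t\in V(C)$, an $(s,t)$-jump over $C$ is an induced $(s,t)$-path $P$ none of whose internal vertices lies in $C$; $P^*$ denotes its set of internal vertices. Let $Q_1,Q_2$ be the two $(s,t)$-paths of $C$ with internal vertex sets $Q_1^*,Q_2^*$; two vertex sets are anti-complete if no edge joins them. $P$ is short if $Q_1^*\cup Q_2^*$ is anti-complete to $P^*$; a short jump is of type-o if the cycle $P\cup Q_1$ is odd (for $C$ even this does not depend on the choice of $Q_1$). $P$ is local across one vertex if $Q_1^*$ consists of a single vertex which has a neighbour in $P^*$ while $Q_2^*$ is anti-complete to $P^*$. A $(u_1,v_1)$-jump and a $(u_2,v_2)$-jump are parallel if $u_2,v_2$ both lie on one of the two $(u_1,v_1)$-paths of $C$ (in particular, jumps sharing an end are parallel); otherwise they are crossing. -}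

module Defs where

open import Data.Nat using (ℕ; zero; suc; _+_; _*_; _∸_; _≤_; _<_; _≤ᵇ_; _%_)
open import Data.Fin using (Fin; toℕ; fromℕ)
open import Data.Bool using (if_then_else_)
open import Data.Product using (Σ; ∃; ∃-syntax; _×_; _,_)
open import Data.Sum using (_⊎_)
open import Data.Empty using (⊥)
open import Relation.Nullary using (¬_; Dec)
open import Relation.Binary.PropositionalEquality using (_≡_; _≢_)
open import Function.Definitions using (Injective)

record Graph : Set₁ where
  field
    n      : ℕ
    Adj    : Fin n → Fin n → Set
    sym    : ∀ {x y} → Adj x y → Adj y x
    irrefl : ∀ {x} → ¬ Adj x x
    dec    : ∀ x y → Dec (Adj x y)

open Graph public

-- forward cyclic distance from i to j in Z/k (value in [0,k))
cdist : ∀ {k} → Fin k → Fin k → ℕ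
cdist {k} i j = if toℕ i ≤ᵇ toℕ j then toℕ j ∸ toℕ i else (k + toℕ j) ∸ toℕ i

CycAdj : ∀ {k} → Fin k → Fin k → Set
CycAdj i j = cdist i j ≡ 1 ⊎ cdist j i ≡ 1

PathAdj : ∀ {m} → Fin m → Fin m → Set
PathAdj i j = toℕ i + 1 ≡ toℕ j ⊎ toℕ j + 1 ≡ toℕ i

_⇔_ : Set → Set → Set
A ⇔ B = (A → B) × (B → A)

IsCycle : (G : Graph) (k : ℕ) → (Fin k → Fin (n G)) → Set
IsCycle G k c = 3 ≤ k × Injective _≡_ _≡_ c × (∀ i j → CycAdj i j → Adj G (c i) (c j))

HasGirth : Graph → ℕ → Set
HasGirth G g = (Σ (Fin g → Fin (n G)) λ c → IsCycle G g c)
             × (∀ k (c : Fin k → Fin (n G)) → IsCycle G k c → g ≤ k)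

IsHole : (G : Graph) (k : ℕ) → (Fin k → Fin (n G)) → Set
IsHole G k c = 4 ≤ k × Injective _≡_ _≡_ c × (∀ i j → Adj G (c i) (c j) ⇔ CycAdj i j)

IsInducedPath : (G : Graph) (m : ℕ) → (Fin (suc m) → Fin (n G)) → Set
IsInducedPath G m p = Injective _≡_ _≡_ p × (∀ i j → Adj G (p i) (p j) ⇔ PathAdj i j)

Even : ℕ → Set
Even k = k % 2 ≡ 0

Odd : ℕ → Set
Odd k = k % 2 ≡ 1

AntiComplete : (G : Graph) → (Fin (n G) → Set) → (Fin (n G) → Set) → Set
AntiComplete G A B = ∀ x y → A x → B y → ¬ Adj G x y

InArc : ∀ {k} → Fin k → Fin k → Fin k → Set
InArc a b j = 0 < cdist a j × cdist a j < cdist a b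

OnClosedArc : ∀ {k} → Fin k → Fin k → Fin k → Set
OnClosedArc a b j = cdist a j ≤ cdist a b

module _ (G : Graph) (k : ℕ) (c : Fin k → Fin (n G)) where

  ArcInt : Fin k → Fin k → Fin (n G) → Set
  ArcInt a b x = ∃[ j ] (InArc a b j × c j ≡ x)

  record Jump : Set where
    field
      s t    : Fin k
      s≢t    : s ≢ t
      nonadj : ¬ Adj G (c s) (c t)
      m      : ℕ
      path   : Fin (suc m) → Fin (n G)
      induced : IsInducedPath G m path
      start  : path Data.Fin.zero ≡ c s
      end    : path (fromℕ m) ≡ c t
      off    : ∀ (i : Fin (suc m)) → 0 < toℕ i → toℕ i < m → ∀ j → path i ≢ c j

  open Jump public

  Int : Jump → Fin (n G) → Set
  Int J x = ∃[ i ] (0 < toℕ i × toℕ i < m J × path J i ≡ x)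

  Short : Jump → Set
  Short J = AntiComplete G (λ x → ArcInt (s J) (t J) x ⊎ ArcInt (t J) (s J) x) (Int J)

  -- short, and P ∪ Q₁ is odd (Q₁ = forward arc s → t, of length cdist s t;
  -- P has m edges)
  TypeO : Jump → Set
  TypeO J = Short J × Odd (m J + cdist (s J) (t J))

  LocalVia : Jump → Fin k → Fin k → Set
  LocalVia J a b =
    (∃[ j₀ ] (InArc a b j₀ × (∀ j → InArc a b j → j ≡ j₀)
             × (∃[ y ] (Int J y × Adj G (c j₀) y))))
    × AntiComplete G (ArcInt b a) (Int J)

  LocalAcrossOne : Jump → Set
  LocalAcrossOne J = LocalVia J (s J) (t J) ⊎ LocalVia J (t J) (s J)

  Parallel : Jump → Jump → Set
  Parallel J₁ J₂ =
      (OnClosedArc (s J₁) (t J₁) (s J₂) × OnClosedArc (s J₁) (t J₁) (t J₂))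
    ⊎ (OnClosedArc (t J₁) (s J₁) (s J₂) × OnClosedArc (t J₁) (s J₁) (t J₂))

  InternallyDisjoint : Jump → Jump → Set
  InternallyDisjoint J₁ J₂ = ∀ x → Int J₁ x → Int J₂ x → ⊥

  SameEnds : Jump → Jump → Set
  SameEnds J₁ J₂ = (s J₁ ≡ s J₂ × t J₁ ≡ t J₂) ⊎ (s J₁ ≡ t J₂ × t J₁ ≡ s J₂)

{-# OPTIONS --safe #-}

-- The even hole C has length k = 2ℓ: it is at least the girth, less than 2ℓ + 2, and even.
--
-- Read a jump P from a to b. Call P an odd detour over the arc a → b of C if the interior of
-- that arc is anticomplete to P*, P together with the arc is odd, and P is longer than the
-- other arc b → a. A short jump of type o is an odd detour over both arcs: with either arc it
-- forms a hole, so by the girth it is at least as long as the other arc, and parity rules out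
-- equality. A jump local across the middle vertex of an arc a → b of length 2 is odd, since an
-- even one would close a triangle or, with the arc b → a, an even hole of length ≥ k + 2; so it
-- is an odd detour over b → a.
--
-- Now let P₂ have its ends at positions x < y on the arc a → b of P₁, and suppose that P₁* and
-- P₂* are anticomplete. Unless one of the relevant arcs has length 2, which forces the two
-- jumps to have the same ends, replacing the segment [x, y] of the arc by P₂ and closing up
-- with P₁ gives a hole of length |P₁| + |a → b| + |P₂| − (y − x). The parity conditions make it
-- even and the length conditions make it at least k + 2, a contradiction.

module Submission where

open import Defs hiding (sym)
open import Data.Nat
open import Data.Nat.Properties
open import Data.Nat.DivMod
open import Data.Nat.Tactic.RingSolver using (solve-∀)
open import Data.Bool using (true; false; T; if_then_else_)
open import Data.Unit using (tt)
open import Data.Fin using (Fin; toℕ; fromℕ)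
import Data.Fin as Fin
open import Data.Fin.Properties using (toℕ-injective; toℕ<n; toℕ-fromℕ<; toℕ-fromℕ; any?)
open import Data.Product using (Σ; ∃-syntax; _×_; _,_; proj₁; proj₂)
open import Data.Sum using (_⊎_; inj₁; inj₂; swap) renaming (map to ⊎-map)
open import Data.Empty using (⊥; ⊥-elim)
open import Function using (_∘_; _∘′_)
open import Relation.Nullary
open import Relation.Binary.PropositionalEquality
open import Relation.Binary.Definitions using (tri<; tri≈; tri>)

infixr 5 _⨾_
_⨾_ : ∀ {A B C : Set} → A ⇔ B → B ⇔ C → A ⇔ C
(f , g) ⨾ (h , k) = h ∘′ f , g ∘′ k

⇔-sym : ∀ {A B : Set} → A ⇔ B → B ⇔ A
⇔-sym (f , g) = g , f

Consecutive : ℕ → ℕ → Set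
Consecutive i j = i + 1 ≡ j ⊎ j + 1 ≡ i

¬consecutive-far : ∀ {i j} → i + 2 ≤ j → ¬ Consecutive i j
¬consecutive-far {i} h (inj₁ refl) = m+1+n≰m (i + 1) (subst (_≤ i + 1) (sym (+-assoc i 1 1)) h)
¬consecutive-far {j = j} h (inj₂ refl) = m+1+n≰m j (subst (_≤ j) (+-assoc j 1 2) h)

consecutive-+ˡ : ∀ d {i j} → Consecutive i j → Consecutive (d + i) (d + j)
consecutive-+ˡ d {i} {j} (inj₁ e) = inj₁ (trans (+-assoc d i 1) (cong (d +_) e))
consecutive-+ˡ d {i} {j} (inj₂ e) = inj₂ (trans (+-assoc d j 1) (cong (d +_) e))

consecutive-cancelˡ : ∀ d {i j} → Consecutive (d + i) (d + j) → Consecutive i j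
consecutive-cancelˡ d {i} {j} (inj₁ e) = inj₁ (+-cancelˡ-≡ d _ _ (trans (sym (+-assoc d i 1)) e))
consecutive-cancelˡ d {i} {j} (inj₂ e) = inj₂ (+-cancelˡ-≡ d _ _ (trans (sym (+-assoc d j 1)) e))

consecutive-∸ˡ : ∀ {m i j} → i ≤ m → j ≤ m → Consecutive (m ∸ i) (m ∸ j) → Consecutive i j
consecutive-∸ˡ {m} i≤m j≤m = swap ∘′ ⊎-map (predecessor i≤m j≤m) (predecessor j≤m i≤m)
  where
    open ≡-Reasoning
    predecessor : ∀ {i j} → i ≤ m → j ≤ m → m ∸ i + 1 ≡ m ∸ j → j + 1 ≡ i
    predecessor {i} {j} i≤m j≤m e = +-cancelˡ-≡ (m ∸ i) _ _ (begin
      m ∸ i + (j + 1)  ≡⟨ cong (m ∸ i +_) (+-comm j 1) ⟩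
      m ∸ i + (1 + j)  ≡⟨ +-assoc (m ∸ i) 1 j ⟨
      m ∸ i + 1 + j    ≡⟨ cong (_+ j) e ⟩
      m ∸ j + j        ≡⟨ m∸n+n≡m j≤m ⟩
      m                ≡⟨ m∸n+n≡m i≤m ⟨
      m ∸ i + i        ∎)

parity-+ : ∀ a b {p q} → a % 2 ≡ p → b % 2 ≡ q → (a + b) % 2 ≡ (p + q) % 2
parity-+ a b refl refl = %-distribˡ-+ a b 2

odd⇒¬even : ∀ a → Odd a → ¬ Even a
odd⇒¬even _ o e with trans (sym o) e
... | ()

even-or-odd : ∀ a → Even a ⊎ Odd a
even-or-odd a with a % 2 | m%n<n a 2
... | 0 | _ = inj₁ refl
... | 1 | _ = inj₂ refl
... | suc (suc _) | s≤s (s≤s ())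

even-+2 : ∀ d → Even (d + 2) → Even d
even-+2 d e = trans (sym ([m+kn]%n≡m%n d 1 2)) e

odd-flip : ∀ a {d₁ d₂} → Odd (a + d₁) → Even (d₁ + d₂) → Odd (a + d₂)
odd-flip a {d₁} {d₂} o e = begin
  (a + d₂) % 2               ≡⟨ [m+kn]%n≡m%n (a + d₂) d₁ 2 ⟨
  (a + d₂ + d₁ * 2) % 2      ≡⟨ cong (_% 2) (regroup a d₁ d₂) ⟩
  (a + d₁ + (d₁ + d₂)) % 2   ≡⟨ parity-+ (a + d₁) (d₁ + d₂) o e ⟩
  1                          ∎
  where
    open ≡-Reasoning
    regroup : ∀ a d₁ d₂ → a + d₂ + d₁ * 2 ≡ a + d₁ + (d₁ + d₂)
    regroup = solve-∀

even-≥2 : ∀ {a} → Even a → 2 ≤ a → a ≡ 2 ⊎ 4 ≤ a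
even-≥2 {2} _ _ = inj₁ refl
even-≥2 {3} () _
even-≥2 {suc (suc (suc (suc a)))} _ _ = inj₂ (s≤s (s≤s (s≤s (s≤s z≤n))))

-- cdist i j is by definition cdistℕ k (toℕ i) (toℕ j).
cdistℕ : ℕ → ℕ → ℕ → ℕ
cdistℕ k p q = if p ≤ᵇ q then q ∸ p else k + q ∸ p

CycSucc : ℕ → ℕ → ℕ → Set
CycSucc k p q = p + 1 ≡ q ⊎ (p + 1 ≡ k × q ≡ 0)

CycConsecutive : ℕ → ℕ → ℕ → Set
CycConsecutive L i j = CycSucc L i j ⊎ CycSucc L j i

cdistℕ-≤ : ∀ k {p q} → p ≤ q → cdistℕ k p q ≡ q ∸ p
cdistℕ-≤ k {p} {q} p≤q with p ≤ᵇ q | ≤⇒≤ᵇ p≤q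
... | true | _ = refl

cdistℕ-> : ∀ k {p q} → q < p → cdistℕ k p q ≡ k + q ∸ p
cdistℕ-> k {p} {q} q<p with p ≤ᵇ q in eq
... | true = contradiction (≤ᵇ⇒≤ p q (subst T (sym eq) tt)) (<⇒≱ q<p)
... | false = refl

cdistℕ-self : ∀ k p → cdistℕ k p p ≡ 0
cdistℕ-self k p = trans (cdistℕ-≤ k {p} ≤-refl) (n∸n≡0 p)

module CyclicDistance (k : ℕ) .{{_ : NonZero k}} where

  %-cong-+ˡ : ∀ z {x y} → x % k ≡ y % k → (z + x) % k ≡ (z + y) % k
  %-cong-+ˡ z {x} {y} e = begin
    (z + x) % k            ≡⟨ %-distribˡ-+ z x k ⟩
    (z % k + x % k) % k    ≡⟨ cong (λ u → (z % k + u) % k) e ⟩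
    (z % k + y % k) % k    ≡⟨ %-distribˡ-+ z y k ⟨
    (z + y) % k            ∎
    where open ≡-Reasoning

  %-cong-+ʳ : ∀ z {x y} → x % k ≡ y % k → (x + z) % k ≡ (y + z) % k
  %-cong-+ʳ z {x} {y} e = subst₂ (λ u v → u % k ≡ v % k) (+-comm z x) (+-comm z y) (%-cong-+ˡ z e)

  %-cancel-+ˡ : ∀ z {x y} → (z + x) % k ≡ (z + y) % k → x % k ≡ y % k
  %-cancel-+ˡ zero e = e
  %-cancel-+ˡ (suc z) e = %-cancel-+ˡ z (suc-cancel e)
    where
      open ≡-Reasoning
      pred[k]+suc : ∀ x → pred k + suc x ≡ x + k
      pred[k]+suc x = trans (+-suc (pred k) x) (trans (cong (_+ x) (suc-pred k)) (+-comm k x))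
      suc-cancel : ∀ {x y} → suc x % k ≡ suc y % k → x % k ≡ y % k
      suc-cancel {x} {y} e = begin
        x % k                    ≡⟨ [m+n]%n≡m%n x k ⟨
        (x + k) % k              ≡⟨ cong (_% k) (pred[k]+suc x) ⟨
        (pred k + suc x) % k     ≡⟨ %-cong-+ˡ (pred k) e ⟩
        (pred k + suc y) % k     ≡⟨ cong (_% k) (pred[k]+suc y) ⟩
        (y + k) % k              ≡⟨ [m+n]%n≡m%n y k ⟩
        y % k                    ∎

  %-injective-< : ∀ {x y} → x < k → y < k → x % k ≡ y % k → x ≡ y
  %-injective-< x<k y<k e = trans (sym (m<n⇒m%n≡m x<k)) (trans e (m<n⇒m%n≡m y<k))

  cdistℕ<k : ∀ {p q} → p < k → q < k → cdistℕ k p q < k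
  cdistℕ<k {p} {q} p<k q<k with p ≤? q
  ... | yes p≤q = subst (_< k) (sym (cdistℕ-≤ k p≤q)) (≤-<-trans (m∸n≤m q p) q<k)
  ... | no p≰q = subst (_< k) (sym (cdistℕ-> k (≰⇒> p≰q)))
      (subst (k + q ∸ p <_) (m+n∸n≡m k p) (∸-monoˡ-< (+-monoʳ-< k (≰⇒> p≰q)) (≤-trans (<⇒≤ p<k) (m≤m+n k q))))

  cdistℕ-% : ∀ {p q} → p < k → (p + cdistℕ k p q) % k ≡ q % k
  cdistℕ-% {p} {q} p<k with p ≤? q
  ... | yes p≤q = cong (_% k) (trans (cong (p +_) (cdistℕ-≤ k p≤q)) (m+[n∸m]≡n p≤q))
  ... | no p≰q = begin
    (p + cdistℕ k p q) % k   ≡⟨ cong (λ d → (p + d) % k) (cdistℕ-> k (≰⇒> p≰q)) ⟩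
    (p + (k + q ∸ p)) % k    ≡⟨ cong (_% k) (m+[n∸m]≡n (≤-trans (<⇒≤ p<k) (m≤m+n k q))) ⟩
    (k + q) % k              ≡⟨ cong (_% k) (+-comm k q) ⟩
    (q + k) % k              ≡⟨ [m+n]%n≡m%n q k ⟩
    q % k                    ∎
    where open ≡-Reasoning

  cdistℕ-unique : ∀ {p q d} → p < k → q < k → d < k → (p + d) % k ≡ q % k → cdistℕ k p q ≡ d
  cdistℕ-unique p<k q<k d<k e =
    %-injective-< (cdistℕ<k p<k q<k) d<k (%-cancel-+ˡ _ (trans (cdistℕ-% p<k) (sym e)))

  cdistℕ-translate : ∀ {a i j} → a < k → i < k → j < k →
                     cdistℕ k i j ≡ cdistℕ k (cdistℕ k a i) (cdistℕ k a j)
  cdistℕ-translate {a} {i} {j} a<k i<k j<k =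
    sym (cdistℕ-unique (cdistℕ<k a<k i<k) (cdistℕ<k a<k j<k) (cdistℕ<k i<k j<k) (%-cancel-+ˡ a (begin
      (a + (u + d)) % k   ≡⟨ cong (_% k) (+-assoc a u d) ⟨
      (a + u + d) % k     ≡⟨ %-cong-+ʳ d (cdistℕ-% a<k) ⟩
      (i + d) % k         ≡⟨ cdistℕ-% i<k ⟩
      j % k               ≡⟨ cdistℕ-% a<k ⟨
      (a + v) % k         ∎)))
    where
      open ≡-Reasoning
      u = cdistℕ k a i
      v = cdistℕ k a j
      d = cdistℕ k i j

  cdistℕ≡1⇒CycSucc : ∀ {p q} → p < k → q < k → cdistℕ k p q ≡ 1 → CycSucc k p q
  cdistℕ≡1⇒CycSucc {p} {q} p<k q<k e = succ (m≤n⇒m<n∨m≡n (subst (_≤ k) (+-comm 1 p) p<k))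
    where
      p+1≡q : (p + 1) % k ≡ q % k
      p+1≡q = subst (λ d → (p + d) % k ≡ q % k) e (cdistℕ-% p<k)
      succ : p + 1 < k ⊎ p + 1 ≡ k → CycSucc k p q
      succ (inj₁ p+1<k) = inj₁ (%-injective-< p+1<k q<k p+1≡q)
      succ (inj₂ p+1≡k) = inj₂ (p+1≡k , trans (sym (m<n⇒m%n≡m q<k))
                                        (trans (sym p+1≡q) (trans (cong (_% k) p+1≡k) (n%n≡0 k))))

  CycSucc⇒cdistℕ≡1 : ∀ {p q} → 2 ≤ k → p < k → q < k → CycSucc k p q → cdistℕ k p q ≡ 1
  CycSucc⇒cdistℕ≡1 2≤k p<k q<k s = cdistℕ-unique p<k q<k 2≤k (succ-% s)
    where
      succ-% : ∀ {p q} → CycSucc k p q → (p + 1) % k ≡ q % k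
      succ-% (inj₁ refl) = refl
      succ-% (inj₂ (refl , refl)) = trans (n%n≡0 k) (sym (m<n⇒m%n≡m (≤-trans (s≤s z≤n) 2≤k)))

data Split (a : ℕ) : ℕ → Set where
  before : ∀ {i} → i < a → Split a i
  after  : ∀ j → Split a (a + j)

split : ∀ a i → Split a i
split zero i = after i
split (suc a) zero = before z<s
split (suc a) (suc i) with split a i
... | before i<a = before (s≤s i<a)
... | after j = after j

append : {A : Set} → ℕ → (ℕ → A) → (ℕ → A) → ℕ → A
append zero x y i = y i
append (suc a) x y zero = x zero
append (suc a) x y (suc i) = append a (x ∘ suc) y i

module _ {A : Set} where

  append-< : ∀ a (x y : ℕ → A) {i} → i < a → append a x y i ≡ x i
  append-< (suc a) x y {zero} _ = refl
  append-< (suc a) x y {suc i} (s≤s i<a) = append-< a (x ∘ suc) y i<a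

  append-+ : ∀ a (x y : ℕ → A) j → append a x y (a + j) ≡ y j
  append-+ zero x y j = refl
  append-+ (suc a) x y j = append-+ a (x ∘ suc) y j

  append-≤ : ∀ a (x y : ℕ → A) {i} → x a ≡ y 0 → i ≤ a → append a x y i ≡ x i
  append-≤ a x y x≡y i≤a with m≤n⇒m<n∨m≡n i≤a
  ... | inj₁ i<a = append-< a x y i<a
  ... | inj₂ refl = trans (cong (append a x y) (sym (+-identityʳ a))) (trans (append-+ a x y 0) (sym x≡y))

CycAdj⇔CycConsecutive : ∀ {L} .{{_ : NonZero L}} → 2 ≤ L → (f g : Fin L) →
                        CycAdj f g ⇔ CycConsecutive L (toℕ f) (toℕ g)
CycAdj⇔CycConsecutive {L} 2≤L f g =
  ⊎-map (cdistℕ≡1⇒CycSucc (toℕ<n f) (toℕ<n g)) (cdistℕ≡1⇒CycSucc (toℕ<n g) (toℕ<n f)) ,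
  ⊎-map (CycSucc⇒cdistℕ≡1 2≤L (toℕ<n f) (toℕ<n g)) (CycSucc⇒cdistℕ≡1 2≤L (toℕ<n g) (toℕ<n f))
  where open CyclicDistance L

data Position (N : ℕ) : ℕ → Set where
  onPath : ∀ {i} → i ≤ N → Position N i
  apex   : Position N (suc N)

position : ∀ {N i} → i < suc (suc N) → Position N i
position i<2+N with m≤n⇒m<n∨m≡n (s≤s⁻¹ i<2+N)
... | inj₁ i<1+N = onPath (s≤s⁻¹ i<1+N)
... | inj₂ refl = apex

consecutive⇔cycConsecutive : ∀ {N i j} → i ≤ N → j ≤ N → Consecutive i j ⇔ CycConsecutive (suc (suc N)) i j
consecutive⇔cycConsecutive {N} i≤N j≤N = ⊎-map inj₁ inj₁ , ⊎-map (noWrap i≤N) (noWrap j≤N)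
  where
    noWrap : ∀ {i j} → i ≤ N → CycSucc (suc (suc N)) i j → i + 1 ≡ j
    noWrap i≤N (inj₁ e) = e
    noWrap {i} i≤N (inj₂ (e , _)) = ⊥-elim (<⇒≢ (s≤s (subst (_≤ suc N) (+-comm 1 i) (s≤s i≤N))) e)

cycConsecutive-apex : ∀ {N i} → i ≤ N → CycConsecutive (suc (suc N)) i (suc N) ⇔ (i ≡ 0 ⊎ i ≡ N)
cycConsecutive-apex {N} {i} i≤N = to , from
  where
    to : CycConsecutive (suc (suc N)) i (suc N) → i ≡ 0 ⊎ i ≡ N
    to (inj₁ (inj₁ e)) = inj₂ (suc-injective (trans (+-comm 1 i) e))
    to (inj₂ (inj₁ e)) = ⊥-elim (<⇒≢ (≤-trans (s≤s i≤N) (m≤m+n (suc N) 1)) (sym e))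
    to (inj₂ (inj₂ (_ , i≡0))) = inj₁ i≡0
    from : i ≡ 0 ⊎ i ≡ N → CycConsecutive (suc (suc N)) i (suc N)
    from (inj₁ refl) = inj₂ (inj₂ (+-comm (suc N) 1 , refl))
    from (inj₂ refl) = inj₁ (inj₁ (+-comm N 1))

¬cycConsecutive-apex-apex : ∀ {N} → ¬ CycConsecutive (suc (suc N)) (suc N) (suc N)
¬cycConsecutive-apex-apex {N} (inj₁ (inj₁ e)) = m+1+n≢m (suc N) e
¬cycConsecutive-apex-apex {N} (inj₂ (inj₁ e)) = m+1+n≢m (suc N) e

module Paths (G : Graph) where

  Vertex : Set
  Vertex = Fin (n G)

  Separated : Vertex → Vertex → Set
  Separated u v = u ≢ v × ¬ Adj G u v

  separated-sym : ∀ {u v} → Separated u v → Separated v u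
  separated-sym (u≢v , ¬uv) = u≢v ∘ sym , ¬uv ∘ Graph.sym G

  adj⇒≢ : ∀ {u v} → Adj G u v → u ≢ v
  adj⇒≢ uv refl = irrefl G uv

  -- Indexing by ℕ makes concatenation and reversal plain index arithmetic; p i for i > m is junk.
  record InducedPath (m : ℕ) (p : ℕ → Vertex) : Set where
    field
      injective : ∀ {i j} → i ≤ m → j ≤ m → p i ≡ p j → i ≡ j
      edge      : ∀ {i} → i < m → Adj G (p i) (p (suc i))
      chordless : ∀ {i j} → i ≤ m → j ≤ m → Adj G (p i) (p j) → Consecutive i j
  open InducedPath public

  consecutive⇒adj : ∀ {m p} → InducedPath m p → ∀ {i j} → i ≤ m → j ≤ m → Consecutive i j → Adj G (p i) (p j)
  consecutive⇒adj {m} {p} P {i} i≤m j≤m (inj₁ refl) =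
    subst (Adj G (p i) ∘ p) (+-comm 1 i) (P .edge (subst (_≤ m) (+-comm i 1) j≤m))
  consecutive⇒adj {m} {p} P {j = j} i≤m j≤m (inj₂ refl) =
    Graph.sym G (subst (Adj G (p j) ∘ p) (+-comm 1 j) (P .edge (subst (_≤ m) (+-comm j 1) i≤m)))

  separated-far : ∀ {m p} → InducedPath m p → ∀ {i j} → j ≤ m → i + 2 ≤ j → Separated (p i) (p j)
  separated-far P {i} j≤m i+2≤j =
    (λ e → <-irrefl (P .injective i≤m j≤m e) (<-≤-trans (m<m+n i z<s) i+2≤j)) ,
    ¬consecutive-far i+2≤j ∘ P .chordless i≤m j≤m
    where i≤m = ≤-trans (m≤m+n i 2) (≤-trans i+2≤j j≤m)

  prefix : ∀ {m p e} → InducedPath m p → e ≤ m → InducedPath e p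
  prefix P e≤m .injective i≤e j≤e = P .injective (≤-trans i≤e e≤m) (≤-trans j≤e e≤m)
  prefix P e≤m .edge i<e = P .edge (<-≤-trans i<e e≤m)
  prefix P e≤m .chordless i≤e j≤e = P .chordless (≤-trans i≤e e≤m) (≤-trans j≤e e≤m)

  suffix : ∀ {d m p} → InducedPath (d + m) p → InducedPath m (λ i → p (d + i))
  suffix {d} P .injective i≤m j≤m = +-cancelˡ-≡ d _ _ ∘ P .injective (+-monoʳ-≤ d i≤m) (+-monoʳ-≤ d j≤m)
  suffix {d} {p = p} P .edge {i} i<m = subst (Adj G (p (d + i)) ∘ p) (sym (+-suc d i)) (P .edge (+-monoʳ-< d i<m))
  suffix {d} P .chordless i≤m j≤m = consecutive-cancelˡ d ∘ P .chordless (+-monoʳ-≤ d i≤m) (+-monoʳ-≤ d j≤m)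

  reverse : ∀ {m p} → InducedPath m p → InducedPath m (λ i → p (m ∸ i))
  reverse {m} P .injective {i} {j} i≤m j≤m = ∸-cancelˡ-≡ i≤m j≤m ∘ P .injective (m∸n≤m m i) (m∸n≤m m j)
  reverse {m} {p} P .edge {i} i<m =
    Graph.sym G (subst (λ l → Adj G (p (m ∸ suc i)) (p l)) m∸[1+i]+1 (P .edge (∸-monoʳ-< z<s i<m)))
    where
      m∸[1+i]+1 : suc (m ∸ suc i) ≡ m ∸ i
      m∸[1+i]+1 = sym (+-∸-assoc 1 i<m)
  reverse {m} P .chordless {i} {j} i≤m j≤m = consecutive-∸ˡ i≤m j≤m ∘ P .chordless (m∸n≤m m i) (m∸n≤m m j)

  module _ {a b x y} (X : InducedPath a x) (Y : InducedPath b y) (x≡y : x a ≡ y 0)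
           (sep : ∀ {i j} → i < a → 0 < j → j ≤ b → Separated (x i) (y j)) where

    private
      w = append a x y

      x≢y : ∀ {i j} → i < a → j ≤ b → x i ≢ y j
      x≢y {j = zero} i<a _ e = <-irrefl (X .injective (<⇒≤ i<a) ≤-refl (trans e (sym x≡y))) i<a
      x≢y {j = suc j} i<a j≤b = proj₁ (sep i<a z<s j≤b)

      x~y : ∀ {i j} → i < a → j ≤ b → Adj G (x i) (y j) → Consecutive i (a + j)
      x~y {i} {zero} i<a _ xy =
        subst (Consecutive i) (sym (+-identityʳ a)) (X .chordless (<⇒≤ i<a) ≤-refl (subst (Adj G (x i)) (sym x≡y) xy))
      x~y {j = suc j} i<a j≤b xy = ⊥-elim (proj₂ (sep i<a z<s j≤b) xy)

    append-induced : InducedPath (a + b) w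
    append-induced .injective {i} {j} i≤ j≤ e with split a i | split a j
    ... | before i<a | before j<a =
      X .injective (<⇒≤ i<a) (<⇒≤ j<a) (trans (sym (append-< a x y i<a)) (trans e (append-< a x y j<a)))
    ... | before i<a | after j′ =
      ⊥-elim (x≢y i<a (+-cancelˡ-≤ a _ _ j≤) (trans (sym (append-< a x y i<a)) (trans e (append-+ a x y j′))))
    ... | after i′ | before j<a =
      ⊥-elim (x≢y j<a (+-cancelˡ-≤ a _ _ i≤) (trans (sym (append-< a x y j<a)) (trans (sym e) (append-+ a x y i′))))
    ... | after i′ | after j′ = cong (a +_) (Y .injective (+-cancelˡ-≤ a _ _ i≤) (+-cancelˡ-≤ a _ _ j≤)
      (trans (sym (append-+ a x y i′)) (trans e (append-+ a x y j′))))
    append-induced .edge {i} i<a+b with split a i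
    ... | before i<a = subst₂ (Adj G) (sym (append-< a x y i<a)) (sym (append-≤ a x y x≡y i<a)) (X .edge i<a)
    ... | after j = subst₂ (Adj G) (sym (append-+ a x y j)) (sym (trans (cong w (sym (+-suc a j))) (append-+ a x y (suc j))))
      (Y .edge (+-cancelˡ-< a _ _ i<a+b))
    append-induced .chordless {i} {j} i≤ j≤ wiwj with split a i | split a j
    ... | before i<a | before j<a =
      X .chordless (<⇒≤ i<a) (<⇒≤ j<a) (subst₂ (Adj G) (append-< a x y i<a) (append-< a x y j<a) wiwj)
    ... | before i<a | after j′ =
      x~y i<a (+-cancelˡ-≤ a _ _ j≤) (subst₂ (Adj G) (append-< a x y i<a) (append-+ a x y j′) wiwj)
    ... | after i′ | before j<a = swap
      (x~y j<a (+-cancelˡ-≤ a _ _ i≤) (subst₂ (Adj G) (append-< a x y j<a) (append-+ a x y i′) (Graph.sym G wiwj)))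
    ... | after i′ | after j′ = consecutive-+ˡ a (Y .chordless (+-cancelˡ-≤ a _ _ i≤) (+-cancelˡ-≤ a _ _ j≤)
      (subst₂ (Adj G) (append-+ a x y i′) (append-+ a x y j′) wiwj))

  Hole : ℕ → Set
  Hole L = Σ (Fin L → Vertex) (IsHole G L)

  Cycle : ℕ → Set
  Cycle L = Σ (Fin L → Vertex) (IsCycle G L)

  adj-cong : ∀ {u u′ v v′} → u ≡ u′ → v ≡ v′ → Adj G u v ⇔ Adj G u′ v′
  adj-cong refl refl = (λ uv → uv) , (λ uv → uv)

  adj-comm : ∀ {u v} → Adj G u v ⇔ Adj G v u
  adj-comm = Graph.sym G , Graph.sym G

  module Apex {N h z} (H : InducedPath N h) (z~h₀ : Adj G z (h 0)) (z~hN : Adj G z (h N))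
              (sep : ∀ {i} → 0 < i → i < N → Separated z (h i)) where

    closed : ℕ → Vertex
    closed = append (suc N) h (λ _ → z)

    closed-path : ∀ {i} → i ≤ N → closed i ≡ h i
    closed-path i≤N = append-< (suc N) h _ (s≤s i≤N)

    closed-apex : closed (suc N) ≡ z
    closed-apex = trans (cong closed (sym (+-identityʳ (suc N)))) (append-+ (suc N) h _ 0)

    apex≢h : ∀ {i} → i ≤ N → z ≢ h i
    apex≢h {zero} _ = adj⇒≢ z~h₀
    apex≢h {suc i} i≤N with m≤n⇒m<n∨m≡n i≤N
    ... | inj₁ i<N = proj₁ (sep z<s i<N)
    ... | inj₂ refl = adj⇒≢ z~hN

    h~apex⇔end : ∀ {i} → i ≤ N → Adj G (h i) z ⇔ (i ≡ 0 ⊎ i ≡ N)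
    h~apex⇔end i≤N = to i≤N , from
      where
        to : ∀ {i} → i ≤ N → Adj G (h i) z → i ≡ 0 ⊎ i ≡ N
        to {zero} _ _ = inj₁ refl
        to {suc i} i≤N hz with m≤n⇒m<n∨m≡n i≤N
        ... | inj₁ i<N = ⊥-elim (proj₂ (sep z<s i<N) (Graph.sym G hz))
        ... | inj₂ i≡N = inj₂ i≡N
        from : ∀ {i} → i ≡ 0 ⊎ i ≡ N → Adj G (h i) z
        from (inj₁ refl) = Graph.sym G z~h₀
        from (inj₂ refl) = Graph.sym G z~hN

    closed-injective : ∀ {i j} → Position N i → Position N j → closed i ≡ closed j → i ≡ j
    closed-injective (onPath i≤N) (onPath j≤N) e =
      H .injective i≤N j≤N (trans (sym (closed-path i≤N)) (trans e (closed-path j≤N)))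
    closed-injective (onPath i≤N) apex e = ⊥-elim (apex≢h i≤N (trans (sym closed-apex) (trans (sym e) (closed-path i≤N))))
    closed-injective apex (onPath j≤N) e = ⊥-elim (apex≢h j≤N (trans (sym closed-apex) (trans e (closed-path j≤N))))
    closed-injective apex apex e = refl

    closed-adjacency : ∀ {i j} → Position N i → Position N j →
                       Adj G (closed i) (closed j) ⇔ CycConsecutive (suc (suc N)) i j
    closed-adjacency (onPath i≤N) (onPath j≤N) =
      adj-cong (closed-path i≤N) (closed-path j≤N) ⨾
      (H .chordless i≤N j≤N , consecutive⇒adj H i≤N j≤N) ⨾ consecutive⇔cycConsecutive i≤N j≤N
    closed-adjacency (onPath i≤N) apex =
      adj-cong (closed-path i≤N) closed-apex ⨾ h~apex⇔end i≤N ⨾ ⇔-sym (cycConsecutive-apex i≤N)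
    closed-adjacency apex (onPath j≤N) =
      adj-cong closed-apex (closed-path j≤N) ⨾ adj-comm ⨾ h~apex⇔end j≤N ⨾ ⇔-sym (cycConsecutive-apex j≤N) ⨾ (swap , swap)
    closed-adjacency apex apex = ⊥-elim ∘ irrefl G , ⊥-elim ∘ ¬cycConsecutive-apex-apex

  closeToHole : ∀ {N h z} → InducedPath N h → 2 ≤ N → Adj G z (h 0) → Adj G z (h N)
              → (∀ {i} → 0 < i → i < N → Separated z (h i)) → Hole (suc (suc N))
  closeToHole H 2≤N z~h₀ z~hN sep = closed ∘ toℕ , s≤s (s≤s 2≤N) , injective′ , adjacency′
    where
      open Apex H z~h₀ z~hN sep
      injective′ : ∀ {f g} → closed (toℕ f) ≡ closed (toℕ g) → f ≡ g
      injective′ {f} {g} = toℕ-injective ∘ closed-injective (position (toℕ<n f)) (position (toℕ<n g))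
      adjacency′ : ∀ f g → Adj G (closed (toℕ f)) (closed (toℕ g)) ⇔ CycAdj f g
      adjacency′ f g = closed-adjacency (position (toℕ<n f)) (position (toℕ<n g)) ⨾
                       ⇔-sym (CycAdj⇔CycConsecutive (s≤s (s≤s z≤n)) f g)

  -- x₁ … x_a = y₀ … y_{b-1} is an induced path, and x₀ = y_b closes it up.
  glueToHole : ∀ {a b x y} → InducedPath a x → InducedPath b y → x 0 ≡ y b → x a ≡ y 0 → 2 ≤ a → 2 ≤ b
             → (∀ {i j} → 0 < i → i < a → 0 < j → j < b → Separated (x i) (y j)) → Hole (a + b)
  glueToHole {suc a} {suc b} {x} {y} X Y x₀≡y_b x_a≡y₀ (s≤s 1≤a) (s≤s 1≤b) sep =
    subst Hole (cong suc (sym (+-suc a b)))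
      (closeToHole H (+-mono-≤ 1≤a 1≤b) z~h₀ z~h_end z-separated)
    where
      h = append a (x ∘ suc) y

      H : InducedPath (a + b) h
      H = append-induced (suffix {1} X) (prefix Y (n≤1+n b)) x_a≡y₀
            (λ i<a 0<j j≤b → sep z<s (s≤s i<a) 0<j (s≤s j≤b))

      z~h₀ : Adj G (x 0) (h 0)
      z~h₀ = subst (Adj G (x 0)) (sym (append-≤ a (x ∘ suc) y x_a≡y₀ z≤n)) (X .edge z<s)

      z~h_end : Adj G (x 0) (h (a + b))
      z~h_end = subst₂ (Adj G) (sym x₀≡y_b) (sym (append-+ a (x ∘ suc) y b)) (Graph.sym G (Y .edge ≤-refl))

      z-separated : ∀ {i} → 0 < i → i < a + b → Separated (x 0) (h i)
      z-separated {i} 0<i i<a+b with split a i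
      ... | before i<a = subst (Separated (x 0)) (sym (append-< a (x ∘ suc) y i<a))
              (separated-far X (m≤n⇒m≤1+n i<a) (s≤s 0<i))
      ... | after j = subst₂ Separated (sym x₀≡y_b) (sym (append-+ a (x ∘ suc) y j))
              (separated-sym (separated-far Y ≤-refl (subst (_≤ suc b) (+-comm 2 j) (s≤s (+-cancelˡ-< a _ _ i<a+b)))))

  isHole⇒isCycle : ∀ {L w} → IsHole G L w → IsCycle G L w
  isHole⇒isCycle (4≤L , w-injective , w-adjacency) = ≤-trans (n≤1+n 3) 4≤L , w-injective , λ f g → proj₂ (w-adjacency f g)

  hole⇒cycle : ∀ {L} → Hole L → Cycle L
  hole⇒cycle (w , hole) = w , isHole⇒isCycle hole

  triangle : ∀ {u v w} → Adj G u v → Adj G v w → Adj G w u → Cycle 3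
  triangle {u} {v} {w} uv vw wu = corner , ≤-refl , corner-injective , λ f g → distinct-adjacent f g ∘ cycAdj⇒≢
    where
      corner : Fin 3 → Vertex
      corner Fin.zero = u
      corner (Fin.suc Fin.zero) = v
      corner (Fin.suc (Fin.suc Fin.zero)) = w

      distinct-adjacent : ∀ f g → f ≢ g → Adj G (corner f) (corner g)
      distinct-adjacent Fin.zero Fin.zero f≢g = ⊥-elim (f≢g refl)
      distinct-adjacent Fin.zero (Fin.suc Fin.zero) _ = uv
      distinct-adjacent Fin.zero (Fin.suc (Fin.suc Fin.zero)) _ = Graph.sym G wu
      distinct-adjacent (Fin.suc Fin.zero) Fin.zero _ = Graph.sym G uv
      distinct-adjacent (Fin.suc Fin.zero) (Fin.suc Fin.zero) f≢g = ⊥-elim (f≢g refl)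
      distinct-adjacent (Fin.suc Fin.zero) (Fin.suc (Fin.suc Fin.zero)) _ = vw
      distinct-adjacent (Fin.suc (Fin.suc Fin.zero)) Fin.zero _ = wu
      distinct-adjacent (Fin.suc (Fin.suc Fin.zero)) (Fin.suc Fin.zero) _ = Graph.sym G vw
      distinct-adjacent (Fin.suc (Fin.suc Fin.zero)) (Fin.suc (Fin.suc Fin.zero)) f≢g = ⊥-elim (f≢g refl)

      corner-injective : ∀ {f g} → corner f ≡ corner g → f ≡ g
      corner-injective {f} {g} e with f Fin.≟ g
      ... | yes f≡g = f≡g
      ... | no f≢g = ⊥-elim (adj⇒≢ (distinct-adjacent f g f≢g) e)

      cycAdj⇒≢ : ∀ {f g : Fin 3} → CycAdj f g → f ≢ g
      cycAdj⇒≢ {f} (inj₁ e) refl = 0≢1+n (trans (sym (cdistℕ-self 3 (toℕ f))) e)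
      cycAdj⇒≢ {f} (inj₂ e) refl = 0≢1+n (trans (sym (cdistℕ-self 3 (toℕ f))) e)

  module Reroute {D m x y A Q} (IA : InducedPath D A) (IQ : InducedPath m Q) (Q₀ : Q 0 ≡ A x) (Q_m : Q m ≡ A y)
                 (x<y : x < y) (y≤D : y ≤ D)
                 (sep : ∀ {i j} → 0 < i → i < m → j ≤ D → j < x ⊎ y < j → Separated (Q i) (A j)) where

    private
      w = D ∸ y
      y+w≡D : y + w ≡ D
      y+w≡D = m+[n∸m]≡n y≤D
      x≤D = ≤-trans (<⇒≤ x<y) y≤D

      tail : ℕ → Vertex
      tail j = A (y + j)

      tail-induced : InducedPath w tail
      tail-induced = suffix (subst (λ l → InducedPath l A) (sym y+w≡D) IA)

      y+j≤D : ∀ {j} → j ≤ w → y + j ≤ D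
      y+j≤D j≤w = ≤-trans (+-monoʳ-≤ y j≤w) (≤-reflexive y+w≡D)

      Q≡tail₀ : Q m ≡ tail 0
      Q≡tail₀ = trans Q_m (cong A (sym (+-identityʳ y)))

      continuation : ℕ → Vertex
      continuation = append m Q tail

      continuation-induced : InducedPath (m + w) continuation
      continuation-induced = append-induced IQ tail-induced Q≡tail₀ separated
        where
          separated : ∀ {i j} → i < m → 0 < j → j ≤ w → Separated (Q i) (tail j)
          separated {zero} {j} _ 0<j j≤w = subst (λ v → Separated v (tail j)) (sym Q₀)
            (separated-far IA (y+j≤D j≤w) (≤-trans (≤-reflexive (+-suc x 1)) (+-mono-≤ x<y 0<j)))
          separated {suc i} i<m 0<j j≤w = sep z<s i<m (y+j≤D j≤w) (inj₂ (m<m+n y 0<j))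

      continuation₀ : continuation 0 ≡ A x
      continuation₀ = trans (append-≤ m Q tail Q≡tail₀ z≤n) Q₀

    route-length : ℕ
    route-length = x + (m + w)

    route : ℕ → Vertex
    route = append x A continuation

    route-induced : InducedPath route-length route
    route-induced = append-induced (prefix IA x≤D) continuation-induced (sym continuation₀) separated
      where
        separated : ∀ {i j} → i < x → 0 < j → j ≤ m + w → Separated (A i) (continuation j)
        separated {i} {j} i<x 0<j j≤m+w with split m j
        ... | before j<m = subst (Separated (A i)) (sym (append-< m Q tail j<m))
          (separated-sym (sep 0<j j<m (≤-trans (<⇒≤ i<x) x≤D) (inj₁ i<x)))
        ... | after j′ = subst (Separated (A i)) (sym (append-+ m Q tail j′))
          (separated-far IA (y+j≤D (+-cancelˡ-≤ m _ _ j≤m+w))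
            (≤-trans (≤-reflexive (+-comm i 2)) (≤-trans (≤-trans (s≤s i<x) x<y) (m≤m+n y j′))))

    route-start : route 0 ≡ A 0
    route-start = append-≤ x A continuation (sym continuation₀) z≤n

    route-end : route route-length ≡ A D
    route-end = trans (append-+ x A continuation (m + w)) (trans (append-+ m Q tail w) (cong A y+w≡D))

    InnerVertex : Vertex → Set
    InnerVertex v = (∃[ j ] (0 < j × j < D × v ≡ A j)) ⊎ (∃[ j ] (0 < j × j < m × v ≡ Q j))

    route-interior : ∀ {i} → 0 < i → i < route-length → InnerVertex (route i)
    route-interior {i} 0<i i<len with split x i
    ... | before i<x = inj₁ (i , 0<i , <-≤-trans (<-trans i<x x<y) y≤D , append-< x A continuation i<x)
    ... | after i′ with split m i′
    ...   | before i′<m = interiorQ i′ 0<i i′<m (trans (append-+ x A continuation i′) (append-< m Q tail i′<m))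
      where
        interiorQ : ∀ i′ → 0 < x + i′ → i′ < m → route (x + i′) ≡ Q i′ → InnerVertex (route (x + i′))
        interiorQ zero 0<x _ e = inj₁ (x , subst (0 <_) (+-identityʳ x) 0<x , <-≤-trans x<y y≤D , trans e Q₀)
        interiorQ (suc i′) _ i′<m e = inj₂ (suc i′ , z<s , i′<m , e)
    ...   | after j = inj₁ (y + j , <-≤-trans (≤-<-trans z≤n x<y) (m≤m+n y j) ,
                             <-≤-trans (+-monoʳ-< y j<w) (≤-reflexive y+w≡D) ,
                             trans (append-+ x A continuation (m + j)) (append-+ m Q tail j))
      where
        j<w : j < w
        j<w = +-cancelˡ-< m _ _ (+-cancelˡ-< x _ _ i<len)

toℕ-mod : ∀ {m i} → i ≤ m → toℕ (i mod suc m) ≡ i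
toℕ-mod {m} {i} i≤m = trans (toℕ-fromℕ< (m%n<n i (suc m))) (m≤n⇒m%n≡m i≤m)

mod-toℕ : ∀ {m} (f : Fin (suc m)) → toℕ f mod suc m ≡ f
mod-toℕ f = toℕ-injective (toℕ-mod (s≤s⁻¹ (toℕ<n f)))

module OnHole (G : Graph) (k : ℕ) .{{_ : NonZero k}} (c : Fin k → Fin (n G)) (C : IsHole G k c) where
  open Paths G
  open CyclicDistance k

  4≤k : 4 ≤ k
  4≤k = proj₁ C

  2≤k : 2 ≤ k
  2≤k = ≤-trans (s≤s (s≤s z≤n)) 4≤k

  c-injective : ∀ {i j} → c i ≡ c j → i ≡ j
  c-injective = proj₁ (proj₂ C)

  c-adj⇔ : ∀ i j → Adj G (c i) (c j) ⇔ CycAdj i j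
  c-adj⇔ = proj₂ (proj₂ C)

  pos : Fin k → ℕ → Fin k
  pos a i = (toℕ a + i) mod k

  cdist<k : ∀ a j → cdist a j < k
  cdist<k a j = cdistℕ<k (toℕ<n a) (toℕ<n j)

  cdist-pos : ∀ a {i} → i < k → cdist a (pos a i) ≡ i
  cdist-pos a {i} i<k = cdistℕ-unique (toℕ<n a) (toℕ<n (pos a i)) i<k
    (trans (sym (m%n%n≡m%n (toℕ a + i) k)) (cong (_% k) (sym (toℕ-fromℕ< (m%n<n (toℕ a + i) k)))))

  cdist-injective : ∀ a {i j} → cdist a i ≡ cdist a j → i ≡ j
  cdist-injective a {i} {j} e = toℕ-injective (%-injective-< (toℕ<n i) (toℕ<n j)
    (trans (sym (cdistℕ-% (toℕ<n a))) (trans (cong (λ d → (toℕ a + d) % k) e) (cdistℕ-% (toℕ<n a)))))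

  pos-cdist : ∀ a j → pos a (cdist a j) ≡ j
  pos-cdist a j = cdist-injective a (cdist-pos a (cdist<k a j))

  cdist-self : ∀ a → cdist a a ≡ 0
  cdist-self a = cdistℕ-self k (toℕ a)

  cdist≡0 : ∀ a {j} → cdist a j ≡ 0 → j ≡ a
  cdist≡0 a e = cdist-injective a (trans e (sym (cdist-self a)))

  pos-0 : ∀ a → pos a 0 ≡ a
  pos-0 a = cdist≡0 a (cdist-pos a (≤-trans (s≤s z≤n) 4≤k))

  cdist-translate : ∀ a i j → cdist i j ≡ cdistℕ k (cdist a i) (cdist a j)
  cdist-translate a i j = cdistℕ-translate (toℕ<n a) (toℕ<n i) (toℕ<n j)

  cdist-pos-pos : ∀ a {i j} → i < k → j < k → cdist (pos a i) (pos a j) ≡ cdistℕ k i j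
  cdist-pos-pos a i<k j<k = trans (cdist-translate a _ _) (cong₂ (cdistℕ k) (cdist-pos a i<k) (cdist-pos a j<k))

  cdist-sum : ∀ {a b} → a ≢ b → cdist a b + cdist b a ≡ k
  cdist-sum {a} {b} a≢b = begin
    cdist a b + cdist b a                     ≡⟨ cong (cdist a b +_) (cdist-translate a b a) ⟩
    cdist a b + cdistℕ k (cdist a b) (cdist a a) ≡⟨ cong (λ d → cdist a b + cdistℕ k (cdist a b) d) (cdist-self a) ⟩
    cdist a b + cdistℕ k (cdist a b) 0          ≡⟨ cong (cdist a b +_) (cdistℕ-> k 0<cdist) ⟩
    cdist a b + (k + 0 ∸ cdist a b)            ≡⟨ m+[n∸m]≡n (≤-trans (<⇒≤ (cdist<k a b)) (m≤m+n k 0)) ⟩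
    k + 0                                      ≡⟨ +-identityʳ k ⟩
    k                                          ∎
    where
      open ≡-Reasoning
      0<cdist : 0 < cdist a b
      0<cdist = n≢0⇒n>0 (λ e → a≢b (sym (cdist≡0 a e)))

  cdist≥2 : ∀ {a b} → a ≢ b → ¬ Adj G (c a) (c b) → 2 ≤ cdist a b
  cdist≥2 {a} {b} a≢b ¬ab with cdist a b in eq
  ... | zero = ⊥-elim (a≢b (sym (cdist≡0 a eq)))
  ... | suc zero = ⊥-elim (¬ab (proj₂ (c-adj⇔ a b) (inj₁ eq)))
  ... | suc (suc _) = s≤s (s≤s z≤n)

  cdist+2≤k : ∀ {a b} → a ≢ b → ¬ Adj G (c a) (c b) → cdist a b + 2 ≤ k
  cdist+2≤k {a} {b} a≢b ¬ab = subst (cdist a b + 2 ≤_) (cdist-sum a≢b)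
    (+-monoʳ-≤ (cdist a b) (cdist≥2 (a≢b ∘ sym) (¬ab ∘ Graph.sym G)))

  arc : ∀ a {D} → D + 2 ≤ k → InducedPath D (c ∘ pos a)
  arc a {D} D+2≤k = record { injective = injective′ ; edge = edge′ ; chordless = chordless′ }
    where
      D+1<k : D + 1 < k
      D+1<k = subst (_≤ k) (+-suc D 1) D+2≤k
      <k : ∀ {i} → i ≤ D → i < k
      <k i≤D = ≤-<-trans (≤-trans i≤D (m≤m+n D 1)) D+1<k
      injective′ : ∀ {i j} → i ≤ D → j ≤ D → c (pos a i) ≡ c (pos a j) → i ≡ j
      injective′ i≤D j≤D e = trans (sym (cdist-pos a (<k i≤D))) (trans (cong (cdist a) (c-injective e)) (cdist-pos a (<k j≤D)))
      edge′ : ∀ {i} → i < D → Adj G (c (pos a i)) (c (pos a (suc i)))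
      edge′ {i} i<D = proj₂ (c-adj⇔ _ _) (inj₁ (trans (cdist-pos-pos a (<k (<⇒≤ i<D)) (<k i<D))
        (CycSucc⇒cdistℕ≡1 2≤k (<k (<⇒≤ i<D)) (<k i<D) (inj₁ (+-comm i 1)))))
      noWrap : ∀ {i j} → i ≤ D → j ≤ D → cdist (pos a i) (pos a j) ≡ 1 → i + 1 ≡ j
      noWrap {i} {j} i≤D j≤D e with cdistℕ≡1⇒CycSucc (<k i≤D) (<k j≤D) (trans (sym (cdist-pos-pos a (<k i≤D) (<k j≤D))) e)
      ... | inj₁ i+1≡j = i+1≡j
      ... | inj₂ (i+1≡k , _) = ⊥-elim (<⇒≢ (≤-<-trans (+-monoˡ-≤ 1 i≤D) D+1<k) i+1≡k)
      chordless′ : ∀ {i j} → i ≤ D → j ≤ D → Adj G (c (pos a i)) (c (pos a j)) → Consecutive i j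
      chordless′ i≤D j≤D = ⊎-map (noWrap i≤D j≤D) (noWrap j≤D i≤D) ∘ proj₁ (c-adj⇔ _ _)

  pos-inArc : ∀ a b {i} → 0 < i → i < cdist a b → InArc a b (pos a i)
  pos-inArc a b {i} 0<i i<D = subst (0 <_) (sym (cdist-pos a i<k)) 0<i , subst (_< cdist a b) (sym (cdist-pos a i<k)) i<D
    where i<k = <-trans i<D (cdist<k a b)

  Interior : Jump G k c → Vertex → Set
  Interior = Int G k c

  interior-off : ∀ J {v} → Interior J v → ∀ j → v ≢ c j
  interior-off J (f , 0<f , f<m , refl) j = off J f 0<f f<m j

  record Traversal (J : Jump G k c) (a b : Fin k) : Set where
    field
      walk     : ℕ → Vertex
      walk-induced : InducedPath (m J) walk
      walk-start   : walk 0 ≡ c a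
      walk-end     : walk (m J) ≡ c b
      walk-interior   : ∀ {i} → 0 < i → i < m J → Interior J (walk i)
      interior-index    : ∀ {v} → Interior J v → ∃[ i ] (0 < i × i < m J × walk i ≡ v)
      a≢b      : a ≢ b
      ¬a~b     : ¬ Adj G (c a) (c b)
  open Traversal public

  forward : ∀ J → Traversal J (s J) (t J)
  forward J = record
    { walk = p ; walk-induced = p-induced
    ; walk-start = trans (cong (path J) (mod-toℕ Fin.zero)) (start J)
    ; walk-end = trans (cong (path J) m-mod) (end J)
    ; walk-interior = λ {i} 0<i i<M → i mod suc M , subst (0 <_) (sym (toℕ-mod (<⇒≤ i<M))) 0<i
                                            , subst (_< M) (sym (toℕ-mod (<⇒≤ i<M))) i<M , refl
    ; interior-index = λ { (f , 0<f , f<M , e) → toℕ f , 0<f , f<M , trans (cong (path J) (mod-toℕ f)) e }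
    ; a≢b = s≢t J ; ¬a~b = nonadj J }
    where
      M = m J
      p : ℕ → Vertex
      p i = path J (i mod suc M)
      m-mod : M mod suc M ≡ fromℕ M
      m-mod = toℕ-injective (trans (toℕ-mod ≤-refl) (sym (toℕ-fromℕ M)))
      p-induced : InducedPath M p
      p-induced .injective i≤M j≤M e =
        trans (sym (toℕ-mod i≤M)) (trans (cong toℕ (proj₁ (induced J) e)) (toℕ-mod j≤M))
      p-induced .edge {i} i<M = proj₂ (proj₂ (induced J) _ _)
        (inj₁ (trans (cong (_+ 1) (toℕ-mod (<⇒≤ i<M))) (trans (+-comm i 1) (sym (toℕ-mod i<M)))))
      p-induced .chordless i≤M j≤M ij =
        subst₂ Consecutive (toℕ-mod i≤M) (toℕ-mod j≤M) (proj₁ (proj₂ (induced J) _ _) ij)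

  backward : ∀ J → Traversal J (t J) (s J)
  backward J = record
    { walk = λ i → F .walk (M ∸ i) ; walk-induced = reverse (F .walk-induced)
    ; walk-start = F .walk-end ; walk-end = trans (cong (F .walk) (n∸n≡0 M)) (F .walk-start)
    ; walk-interior = λ {i} 0<i i<M → F .walk-interior (m<n⇒0<n∸m i<M) (∸-monoʳ-< 0<i (<⇒≤ i<M))
    ; interior-index = reindex
    ; a≢b = s≢t J ∘ sym ; ¬a~b = nonadj J ∘ Graph.sym G }
    where
      M = m J
      F = forward J
      reindex : ∀ {v} → Interior J v → ∃[ i ] (0 < i × i < M × F .walk (M ∸ i) ≡ v)
      reindex v∈J with F .interior-index v∈J
      ... | i , 0<i , i<M , e = M ∸ i , m<n⇒0<n∸m i<M , ∸-monoʳ-< 0<i (<⇒≤ i<M)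
                              , trans (cong (F .walk) (m∸[m∸n]≡n (<⇒≤ i<M))) e

  module _ {J a b} (T : Traversal J a b) where

    walk-off : ∀ {i} → 0 < i → i < m J → ∀ j → T .walk i ≢ c j
    walk-off 0<i i<m = interior-off J (T .walk-interior 0<i i<m)

    length≥2 : 2 ≤ m J
    length≥2 = bound (m J) (T .walk-induced) (T .walk-start) (T .walk-end)
      where
        bound : ∀ M {p} → InducedPath M p → p 0 ≡ c a → p M ≡ c b → 2 ≤ M
        bound zero P p₀ p_M = ⊥-elim (T .a≢b (c-injective (trans (sym p₀) p_M)))
        bound (suc zero) P p₀ p_M = ⊥-elim (T .¬a~b (subst₂ (Adj G) p₀ p_M (P .edge z<s)))
        bound (suc (suc M)) P p₀ p_M = s≤s (s≤s z≤n)

    traversalHole : AntiComplete G (ArcInt G k c a b) (Interior J) → Hole (m J + cdist a b)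
    traversalHole anti = glueToHole (T .walk-induced) (reverse (arc a (cdist+2≤k (T .a≢b) (T .¬a~b))))
      (trans (T .walk-start) (cong c (sym (trans (cong (pos a) (n∸n≡0 D)) (pos-0 a)))))
      (trans (T .walk-end) (cong c (sym (pos-cdist a b))))
      length≥2 (cdist≥2 (T .a≢b) (T .¬a~b)) separated
      where
        D = cdist a b
        separated : ∀ {i j} → 0 < i → i < m J → 0 < j → j < D → Separated (T .walk i) (c (pos a (D ∸ j)))
        separated {j = j} 0<i i<m 0<j j<D = walk-off 0<i i<m _ ,
          anti _ _ (pos a (D ∸ j) , pos-inArc a b (m<n⇒0<n∸m j<D) (∸-monoʳ-< 0<j (<⇒≤ j<D)) , refl)
                   (T .walk-interior 0<i i<m) ∘ Graph.sym G

  module _ (a : Fin k) {e₁ e₂ : Fin k} (x<y : cdist a e₁ < cdist a e₂) where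

    private
      x = cdist a e₁
      y = cdist a e₂

    cdist-inner : cdist e₁ e₂ ≡ y ∸ x
    cdist-inner = trans (cdist-translate a e₁ e₂) (cdistℕ-≤ k (<⇒≤ x<y))

    cdist-outer : cdist e₂ e₁ ≡ k + x ∸ y
    cdist-outer = trans (cdist-translate a e₂ e₁) (cdistℕ-> k x<y)

    inArc-outer : ∀ {j} → j < k → j < x ⊎ y < j → InArc e₂ e₁ (pos a j)
    inArc-outer {j} j<k (inj₂ y<j) = subst (0 <_) (sym from-e₂) (m<n⇒0<n∸m y<j) ,
      subst₂ _<_ (sym from-e₂) (sym cdist-outer) (∸-monoˡ-< (<-≤-trans j<k (m≤m+n k x)) (<⇒≤ y<j))
      where
        from-e₂ : cdist e₂ (pos a j) ≡ j ∸ y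
        from-e₂ = trans (cdist-translate a e₂ (pos a j)) (trans (cong (cdistℕ k y) (cdist-pos a j<k)) (cdistℕ-≤ k (<⇒≤ y<j)))
    inArc-outer {j} j<k (inj₁ j<x) = subst (0 <_) (sym from-e₂) (m<n⇒0<n∸m (<-≤-trans (cdist<k a e₂) (m≤m+n k j))) ,
      subst₂ _<_ (sym from-e₂) (sym cdist-outer) (∸-monoˡ-< (+-monoʳ-< k j<x) (≤-trans (<⇒≤ (cdist<k a e₂)) (m≤m+n k j)))
      where
        from-e₂ : cdist e₂ (pos a j) ≡ k + j ∸ y
        from-e₂ = trans (cdist-translate a e₂ (pos a j)) (trans (cong (cdistℕ k y) (cdist-pos a j<k)) (cdistℕ-> k (<-trans j<x x<y)))

  cdist-determines : ∀ a {e₁ e₂ b} → cdist a e₁ ≡ 0 × cdist a e₂ ≡ cdist a b → e₁ ≡ a × e₂ ≡ b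
  cdist-determines a (x≡0 , y≡D) = cdist≡0 a x≡0 , cdist-injective a y≡D

reroute-parity : ∀ {x y D m₁ m₂} → x ≤ y → y ≤ D → Odd (m₂ + (y ∸ x)) → Odd (m₁ + D) →
                 Even (x + (m₂ + (D ∸ y)) + m₁)
reroute-parity {x} {y} {D} {m₁} {m₂} x≤y y≤D with m≤n⇒∃[o]m+o≡n x≤y | m≤n⇒∃[o]m+o≡n y≤D
... | d , refl | w , refl rewrite m+n∸m≡n x d | m+n∸m≡n (x + d) w = λ o₂ o₁ → begin
  (x + (m₂ + w) + m₁) % 2               ≡⟨ [m+kn]%n≡m%n (x + (m₂ + w) + m₁) d 2 ⟨
  (x + (m₂ + w) + m₁ + d * 2) % 2       ≡⟨ cong (_% 2) (regroup x d w m₁ m₂) ⟩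
  (m₂ + d + (m₁ + (x + d + w))) % 2     ≡⟨ parity-+ (m₂ + d) (m₁ + (x + d + w)) o₂ o₁ ⟩
  0                                     ∎
  where
    open ≡-Reasoning
    regroup : ∀ x d w m₁ m₂ → x + (m₂ + w) + m₁ + d * 2 ≡ m₂ + d + (m₁ + (x + d + w))
    regroup = solve-∀

reroute-longer : ∀ {x y D m₁ m₂} → x ≤ y → y ≤ D → y ∸ x < m₂ → m₁ + D < x + (m₂ + (D ∸ y)) + m₁
reroute-longer {x} {y} {D} {m₁} {m₂} x≤y y≤D with m≤n⇒∃[o]m+o≡n x≤y | m≤n⇒∃[o]m+o≡n y≤D
... | d , refl | w , refl rewrite m+n∸m≡n x d | m+n∸m≡n (x + d) w = λ d<m₂ →
  +-cancelʳ-< d _ _ (subst (m₁ + (x + d + w) + d <_) (regroup x d w m₁ m₂) (+-monoʳ-< (m₁ + (x + d + w)) d<m₂))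
  where
    regroup : ∀ x d w m₁ m₂ → m₁ + (x + d + w) + m₂ ≡ x + (m₂ + w) + m₁ + d
    regroup = solve-∀

squeeze-short-arc : ∀ {x y D} → x + 2 ≤ y → y ≤ D → D ≡ 2 → x ≡ 0 × y ≡ D
squeeze-short-arc {x} x+2≤y y≤D refl =
  n≤0⇒n≡0 (+-cancelʳ-≤ 2 x 0 (≤-trans x+2≤y y≤D)) , ≤-antisym y≤D (≤-trans (m≤n+m 2 x) x+2≤y)

squeeze-short-outer-arc : ∀ {k x y D} → y ≤ D → D + 2 ≤ k → k + x ∸ y ≡ 2 → x ≡ 0 × y ≡ D
squeeze-short-outer-arc {k} {x} {y} {D} y≤D D+2≤k outer≡2 = x≡0 , ≤-antisym y≤D D≤y
  where
    k+x≡2+y : k + x ≡ 2 + y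
    k+x≡2+y = trans (sym (m∸n+n≡m (≤-trans (≤-trans y≤D (m+n≤o⇒m≤o D D+2≤k)) (m≤m+n k x)))) (cong (_+ y) outer≡2)
    2+y≤k : 2 + y ≤ k
    2+y≤k = ≤-trans (+-monoʳ-≤ 2 y≤D) (subst (_≤ k) (+-comm D 2) D+2≤k)
    x≡0 : x ≡ 0
    x≡0 = n≤0⇒n≡0 (+-cancelˡ-≤ k x 0 (subst (k + x ≤_) (sym (+-identityʳ k)) (≤-trans (≤-reflexive k+x≡2+y) 2+y≤k)))
    D≤y : D ≤ y
    D≤y = +-cancelʳ-≤ 2 D y (subst₂ _≤_ refl (+-comm 2 y)
            (≤-trans D+2≤k (≤-reflexive (trans (sym (+-identityʳ k)) (trans (cong (k +_) (sym x≡0)) k+x≡2+y)))))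

module Extremal (G : Graph) (k : ℕ) .{{_ : NonZero k}} (c : Fin k → Fin (n G)) (C : IsHole G k c)
                (girth : ∀ {L} → Paths.Cycle G L → k ≤ L)
                (noLongEvenHole : ∀ {L} → Paths.Hole G L → Even L → ¬ (k + 2 ≤ L))
                (k-even : Even k) where
  open Paths G
  open OnHole G k c C

  AnticompleteToArc : Jump G k c → Fin k → Fin k → Set
  AnticompleteToArc J a b = AntiComplete G (ArcInt G k c a b) (Interior J)

  OddDetour : Jump G k c → Fin k → Fin k → Set
  OddDetour J a b = AnticompleteToArc J a b × Odd (m J + cdist a b) × cdist b a < m J

  ShortOddOrLocalFrom : Jump G k c → Fin k → Fin k → Set
  ShortOddOrLocalFrom J a b =
    (AnticompleteToArc J a b × Odd (m J + cdist a b)) ⊎ LocalVia G k c J a b ⊎ LocalVia G k c J b a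

  module _ {J a b} (T : Traversal J a b) where

    private
      D′+D≡k : cdist b a + cdist a b ≡ k
      D′+D≡k = trans (+-comm (cdist b a) (cdist a b)) (cdist-sum (T .a≢b))

    short-odd⇒oddDetour : AnticompleteToArc J a b → Odd (m J + cdist a b) → OddDetour J a b
    short-odd⇒oddDetour anti odd = anti , odd , ≤∧≢⇒< D′≤m D′≢m
      where
        D′≤m : cdist b a ≤ m J
        D′≤m = +-cancelʳ-≤ (cdist a b) _ _
          (subst (_≤ m J + cdist a b) (sym D′+D≡k) (girth (hole⇒cycle (traversalHole T anti))))
        D′≢m : cdist b a ≢ m J
        D′≢m D′≡m = odd⇒¬even (m J + cdist a b) odd (subst (λ l → Even (l + cdist a b)) D′≡m (subst Even (sym D′+D≡k) k-even))

    localVia⇒arc₂ : LocalVia G k c J a b → cdist a b ≡ 2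
    localVia⇒arc₂ ((j₀ , _ , unique , _) , _) with 3 ≤? cdist a b
    ... | no D≱3 = ≤-antisym (s≤s⁻¹ (≰⇒> D≱3)) (cdist≥2 (T .a≢b) (T .¬a~b))
    ... | yes 3≤D = ⊥-elim (1≢2 (begin
      1                   ≡⟨ cdist-pos a (≤-trans (s≤s (s≤s z≤n)) 2≤k) ⟨
      cdist a (pos a 1)   ≡⟨ cong (cdist a) (trans (unique _ (pos-inArc a b z<s (≤-trans (s≤s (s≤s z≤n)) 3≤D)))
                                                   (sym (unique _ (pos-inArc a b z<s 3≤D)))) ⟩
      cdist a (pos a 2)   ≡⟨ cdist-pos a (≤-trans (s≤s (s≤s (s≤s z≤n))) 4≤k) ⟩
      2                   ∎))
      where
        open ≡-Reasoning
        1≢2 : 1 ≢ 2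
        1≢2 ()

    localVia-length≢2 : LocalVia G k c J a b → m J ≢ 2
    localVia-length≢2 L@((j₀ , j₀∈ , _ , y , y∈J , j₀~y) , _) m≡2 with T .interior-index y∈J
    ... | i , 0<i , i<m , walk-i≡y = <⇒≱ 4≤k (girth (triangle a~walk₁ walk₁~j₀ j₀~a))
      where
        i≡1 : i ≡ 1
        i≡1 = ≤-antisym (s≤s⁻¹ (subst (i <_) m≡2 i<m)) 0<i
        a~walk₁ : Adj G (c a) (T .walk 1)
        a~walk₁ = subst (λ v → Adj G v (T .walk 1)) (T .walk-start) (T .walk-induced .edge (<-≤-trans z<s (length≥2 T)))
        walk₁~j₀ : Adj G (T .walk 1) (c j₀)
        walk₁~j₀ = Graph.sym G (subst (Adj G (c j₀)) (sym (trans (cong (T .walk) (sym i≡1)) walk-i≡y)) j₀~y)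
        j₀~a : Adj G (c j₀) (c a)
        j₀~a = proj₂ (c-adj⇔ j₀ a) (inj₂ (≤-antisym (s≤s⁻¹ (subst (cdist a j₀ <_) (localVia⇒arc₂ L) (proj₂ j₀∈))) (proj₁ j₀∈)))

  module _ {J a b} (T : Traversal J a b) (T′ : Traversal J b a) where

    localVia⇒odd : LocalVia G k c J a b → Odd (m J)
    localVia⇒odd L@(_ , anti′) with even-or-odd (m J)
    ... | inj₂ odd = odd
    ... | inj₁ even with even-≥2 even (length≥2 T)
    ...   | inj₁ m≡2 = ⊥-elim (localVia-length≢2 T L m≡2)
    ...   | inj₂ 4≤m = ⊥-elim (noLongEvenHole (traversalHole T′ anti′) (parity-+ (m J) (cdist b a) even D′-even) long)
      where
        D′+2≡k : cdist b a + 2 ≡ k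
        D′+2≡k = trans (cong (cdist b a +_) (sym (localVia⇒arc₂ T L))) (cdist-sum (T′ .a≢b))
        D′-even : Even (cdist b a)
        D′-even = even-+2 (cdist b a) (subst Even (sym D′+2≡k) k-even)
        long : k + 2 ≤ m J + cdist b a
        long = subst (_≤ m J + cdist b a)
          (trans (+-comm 4 (cdist b a)) (trans (sym (+-assoc (cdist b a) 2 2)) (cong (_+ 2) D′+2≡k)))
          (+-monoˡ-≤ (cdist b a) 4≤m)

  module _ {J a b} (T : Traversal J a b) (T′ : Traversal J b a) where

    oddDetour-or-arc₂ : ShortOddOrLocalFrom J a b → OddDetour J a b ⊎ cdist a b ≡ 2
    oddDetour-or-arc₂ (inj₁ (anti , odd)) = inj₁ (short-odd⇒oddDetour T anti odd)
    oddDetour-or-arc₂ (inj₂ (inj₁ L)) = inj₂ (localVia⇒arc₂ T L)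
    oddDetour-or-arc₂ (inj₂ (inj₂ L@(_ , anti))) =
      inj₁ (anti , parity-+ (m J) (cdist a b) (localVia⇒odd T′ T L) D-even , subst (_< m J) (sym D′≡2) 3≤m)
      where
        D′≡2 : cdist b a ≡ 2
        D′≡2 = localVia⇒arc₂ T′ L
        D-even : Even (cdist a b)
        D-even = even-+2 (cdist a b) (subst Even (sym (trans (cong (cdist a b +_) (sym D′≡2)) (cdist-sum (T .a≢b)))) k-even)
        3≤m : 3 ≤ m J
        3≤m = ≤∧≢⇒< (length≥2 T) (localVia-length≢2 T′ L ∘ sym)

  ShortOddOrLocal : Jump G k c → Set
  ShortOddOrLocal J = TypeO G k c J ⊎ LocalAcrossOne G k c J

  module _ (J : Jump G k c) (h : ShortOddOrLocal J) where

    forward-oddDetour-or-arc₂ : OddDetour J (s J) (t J) ⊎ cdist (s J) (t J) ≡ 2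
    forward-oddDetour-or-arc₂ = oddDetour-or-arc₂ (forward J) (backward J) (orient h)
      where
        orient : ShortOddOrLocal J → ShortOddOrLocalFrom J (s J) (t J)
        orient (inj₁ (short , odd)) = inj₁ ((λ u v u∈ v∈ → short u v (inj₁ u∈) v∈) , odd)
        orient (inj₂ L) = inj₂ L

    backward-oddDetour-or-arc₂ : OddDetour J (t J) (s J) ⊎ cdist (t J) (s J) ≡ 2
    backward-oddDetour-or-arc₂ = oddDetour-or-arc₂ (backward J) (forward J) (orient h)
      where
        orient : ShortOddOrLocal J → ShortOddOrLocalFrom J (t J) (s J)
        orient (inj₁ (short , odd)) = inj₁ ((λ u v u∈ v∈ → short u v (inj₂ u∈) v∈) ,
          odd-flip (m J) odd (subst Even (sym (cdist-sum (s≢t J))) k-even))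
        orient (inj₂ L) = inj₂ (swap L)

  module _ (J₁ J₂ : Jump G k c) (disjoint : InternallyDisjoint G k c J₁ J₂)
           (anticomplete : AntiComplete G (Interior J₁) (Interior J₂)) where

    -- The arc a → b with its segment from e₁ to e₂ replaced by J₂, closed up by J₁.
    reroutedHole : ∀ {a b e₁ e₂} → Traversal J₁ a b → AnticompleteToArc J₁ a b
      → Traversal J₂ e₁ e₂ → AnticompleteToArc J₂ e₂ e₁ → (x<y : cdist a e₁ < cdist a e₂) → cdist a e₂ ≤ cdist a b
      → Hole (cdist a e₁ + (m J₂ + (cdist a b ∸ cdist a e₂)) + m J₁)
    reroutedHole {a} {b} {e₁} {e₂} T₁ anti₁ T₂ anti₂ x<y y≤D = glueToHole route-induced (reverse (T₁ .walk-induced))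
      (trans route-start (trans (cong c (pos-0 a)) (sym (trans (cong P (n∸n≡0 m₁)) (T₁ .walk-start)))))
      (trans route-end (trans (cong c (pos-cdist a b)) (sym (T₁ .walk-end))))
      (≤-trans (length≥2 T₂) (≤-trans (m≤m+n (m J₂) _) (m≤n+m _ (cdist a e₁)))) (length≥2 T₁) separated
      where
        m₁ = m J₁
        A = c ∘ pos a
        P = T₁ .walk
        Q = T₂ .walk

        Q-separated : ∀ {i j} → 0 < i → i < m J₂ → j ≤ cdist a b → j < cdist a e₁ ⊎ cdist a e₂ < j → Separated (Q i) (A j)
        Q-separated {i} {j} 0<i i<m₂ j≤D outside = walk-off T₂ 0<i i<m₂ (pos a j) ,
          anti₂ (A j) (Q i) (pos a j , inArc-outer a x<y (≤-<-trans j≤D (cdist<k a b)) outside , refl)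
                (T₂ .walk-interior 0<i i<m₂) ∘ Graph.sym G

        open Reroute (arc a (cdist+2≤k (T₁ .a≢b) (T₁ .¬a~b))) (T₂ .walk-induced)
          (trans (T₂ .walk-start) (cong c (sym (pos-cdist a e₁)))) (trans (T₂ .walk-end) (cong c (sym (pos-cdist a e₂))))
          x<y y≤D Q-separated

        separated : ∀ {i j} → 0 < i → i < route-length → 0 < j → j < m₁ → Separated (route i) (P (m₁ ∸ j))
        separated {i} {j} 0<i i<len 0<j j<m₁ = separated′ (route-interior 0<i i<len)
          where
            p∈J₁ : Interior J₁ (P (m₁ ∸ j))
            p∈J₁ = T₁ .walk-interior (m<n⇒0<n∸m j<m₁) (∸-monoʳ-< 0<j (<⇒≤ j<m₁))
            separated′ : InnerVertex (route i) → Separated (route i) (P (m₁ ∸ j))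
            separated′ (inj₁ (j′ , 0<j′ , j′<D , e)) = subst (λ v → Separated v (P (m₁ ∸ j))) (sym e)
              (interior-off J₁ p∈J₁ (pos a j′) ∘ sym , anti₁ (A j′) _ (pos a j′ , pos-inArc a b 0<j′ j′<D , refl) p∈J₁)
            separated′ (inj₂ (j′ , 0<j′ , j′<m₂ , e)) = subst (λ v → Separated v (P (m₁ ∸ j))) (sym e)
              ((λ q≡p → disjoint _ p∈J₁ (subst (Interior J₂) q≡p (T₂ .walk-interior 0<j′ j′<m₂))) ,
               anticomplete _ _ p∈J₁ (T₂ .walk-interior 0<j′ j′<m₂) ∘ Graph.sym G)

    nested-oddDetours-impossible : ∀ {a b e₁ e₂} → Traversal J₁ a b → OddDetour J₁ a b
      → Traversal J₂ e₁ e₂ → OddDetour J₂ e₂ e₁ → cdist a e₁ < cdist a e₂ → cdist a e₂ ≤ cdist a b → ⊥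
    nested-oddDetours-impossible {a} {b} {e₁} {e₂} T₁ (anti₁ , odd₁ , D′<m₁) T₂ (anti₂ , odd₂ , inner<m₂) x<y y≤D =
      noLongEvenHole (reroutedHole T₁ anti₁ T₂ anti₂ x<y y≤D) even long
      where
        D = cdist a b
        x = cdist a e₁
        y = cdist a e₂
        m₁ = m J₁
        m₂ = m J₂

        even : Even (x + (m₂ + (D ∸ y)) + m₁)
        even = reroute-parity (<⇒≤ x<y) y≤D
          (subst (λ d → Odd (m₂ + d)) (cdist-inner a x<y)
            (odd-flip m₂ odd₂ (subst Even (sym (cdist-sum (T₂ .a≢b ∘ sym))) k-even)))
          odd₁

        long : k + 2 ≤ x + (m₂ + (D ∸ y)) + m₁
        long = subst (_≤ x + (m₂ + (D ∸ y)) + m₁) (+-comm 2 k) (≤-trans (s≤s k<m₁+D)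
          (reroute-longer (<⇒≤ x<y) y≤D (subst (_< m₂) (cdist-inner a x<y) inner<m₂)))
          where
            k<m₁+D : k < m₁ + D
            k<m₁+D = subst (_≤ m₁ + D) (cong suc (trans (+-comm (cdist b a) D) (cdist-sum (T₁ .a≢b))))
                       (+-monoˡ-≤ D D′<m₁)

    nested-jumps-share-ends : ∀ {a b e₁ e₂} → Traversal J₁ a b → OddDetour J₁ a b ⊎ cdist a b ≡ 2
      → Traversal J₂ e₁ e₂ → OddDetour J₂ e₂ e₁ ⊎ cdist e₂ e₁ ≡ 2
      → cdist a e₁ < cdist a e₂ → cdist a e₂ ≤ cdist a b → e₁ ≡ a × e₂ ≡ b
    nested-jumps-share-ends {a} {b} {e₁} {e₂} T₁ framed₁ T₂ framed₂ x<y y≤D = cases framed₁ framed₂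
      where
        x+2≤y : cdist a e₁ + 2 ≤ cdist a e₂
        x+2≤y = ≤-trans (+-monoʳ-≤ (cdist a e₁) (subst (2 ≤_) (cdist-inner a x<y) (cdist≥2 (T₂ .a≢b) (T₂ .¬a~b))))
                        (≤-reflexive (m+[n∸m]≡n (<⇒≤ x<y)))
        cases : OddDetour J₁ a b ⊎ cdist a b ≡ 2 → OddDetour J₂ e₂ e₁ ⊎ cdist e₂ e₁ ≡ 2 → e₁ ≡ a × e₂ ≡ b
        cases (inj₁ d₁) (inj₁ d₂) = ⊥-elim (nested-oddDetours-impossible T₁ d₁ T₂ d₂ x<y y≤D)
        cases (inj₂ D≡2) _ = cdist-determines a (squeeze-short-arc x+2≤y y≤D D≡2)
        cases (inj₁ _) (inj₂ outer≡2) = cdist-determines a (squeeze-short-outer-arc y≤D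
          (cdist+2≤k (T₁ .a≢b) (T₁ .¬a~b)) (trans (sym (cdist-outer a x<y)) outer≡2))

    jump-within-arc-shares-ends : ∀ {a b} → ShortOddOrLocal J₂ → Traversal J₁ a b → OddDetour J₁ a b ⊎ cdist a b ≡ 2
      → cdist a (s J₂) ≤ cdist a b → cdist a (t J₂) ≤ cdist a b
      → (s J₂ ≡ a × t J₂ ≡ b) ⊎ (t J₂ ≡ a × s J₂ ≡ b)
    jump-within-arc-shares-ends {a} h₂ T₁ framed₁ s₂≤D t₂≤D with <-cmp (cdist a (s J₂)) (cdist a (t J₂))
    ... | tri< s₂<t₂ _ _ = inj₁ (nested-jumps-share-ends T₁ framed₁ (forward J₂) (backward-oddDetour-or-arc₂ J₂ h₂) s₂<t₂ t₂≤D)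
    ... | tri≈ _ s₂≡t₂ _ = ⊥-elim (s≢t J₂ (cdist-injective a s₂≡t₂))
    ... | tri> _ _ t₂<s₂ = inj₂ (nested-jumps-share-ends T₁ framed₁ (backward J₂) (forward-oddDetour-or-arc₂ J₂ h₂) t₂<s₂ s₂≤D)

    parallel-jumps-share-ends : ShortOddOrLocal J₁ → ShortOddOrLocal J₂ → Parallel G k c J₁ J₂ → SameEnds G k c J₁ J₂
    parallel-jumps-share-ends h₁ h₂ (inj₁ (s₂≤D , t₂≤D))
      with jump-within-arc-shares-ends h₂ (forward J₁) (forward-oddDetour-or-arc₂ J₁ h₁) s₂≤D t₂≤D
    ... | inj₁ (s₂≡s₁ , t₂≡t₁) = inj₁ (sym s₂≡s₁ , sym t₂≡t₁)
    ... | inj₂ (t₂≡s₁ , s₂≡t₁) = inj₂ (sym t₂≡s₁ , sym s₂≡t₁)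
    parallel-jumps-share-ends h₁ h₂ (inj₂ (s₂≤D , t₂≤D))
      with jump-within-arc-shares-ends h₂ (backward J₁) (backward-oddDetour-or-arc₂ J₁ h₁) s₂≤D t₂≤D
    ... | inj₁ (s₂≡t₁ , t₂≡s₁) = inj₂ (sym t₂≡s₁ , sym s₂≡t₁)
    ... | inj₂ (t₂≡t₁ , s₂≡s₁) = inj₁ (sym s₂≡s₁ , sym t₂≡t₁)

even-squeeze : ∀ {g k} → Even g → Even k → g ≤ k → ¬ (g + 2 ≤ k) → k ≡ g
even-squeeze {g} {k} g-even k-even g≤k k≱g+2 with m≤n⇒m<n∨m≡n g≤k
... | inj₂ g≡k = sym g≡k
... | inj₁ g<k = ⊥-elim (odd⇒¬even (g + 1) (parity-+ g 1 g-even refl) (subst Even k≡g+1 k-even))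
  where
    k≡g+1 : k ≡ g + 1
    k≡g+1 = ≤-antisym (s≤s⁻¹ (subst (k <_) (+-suc g 1) (≰⇒> k≱g+2))) (subst (_≤ k) (+-comm 1 g) g<k)

interiors-adjacent-or-anticomplete : ∀ {G k c} (J₁ J₂ : Jump G k c) →
  (∃[ x ] ∃[ y ] (Int G k c J₁ x × Int G k c J₂ y × Adj G x y)) ⊎ AntiComplete G (Int G k c J₁) (Int G k c J₂)
interiors-adjacent-or-anticomplete {G} J₁ J₂ with any? (λ f₁ → any? (linked? f₁))
  where
    Inner : ∀ {M} → Fin (suc M) → Set
    Inner {M} f = 0 < toℕ f × toℕ f < M
    inner? : ∀ {M} (f : Fin (suc M)) → Dec (Inner f)
    inner? {M} f = (0 <? toℕ f) ×-dec (toℕ f <? M)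
    linked? : ∀ f₁ f₂ → Dec (Inner f₁ × Inner f₂ × Adj G (path J₁ f₁) (path J₂ f₂))
    linked? f₁ f₂ = inner? f₁ ×-dec inner? f₂ ×-dec dec G (path J₁ f₁) (path J₂ f₂)
... | yes (f₁ , f₂ , (0<f₁ , f₁<m) , (0<f₂ , f₂<m) , adj) =
  inj₁ (path J₁ f₁ , path J₂ f₂ , (f₁ , 0<f₁ , f₁<m , refl) , (f₂ , 0<f₂ , f₂<m , refl) , adj)
... | no unlinked = inj₂ λ { _ _ (f₁ , 0<f₁ , f₁<m , refl) (f₂ , 0<f₂ , f₂<m , refl) adj →
  unlinked (f₁ , f₂ , (0<f₁ , f₁<m) , (0<f₂ , f₂<m) , adj) }

lemma4p2 : (ℓ : ℕ) → 2 ≤ ℓ → (G : Graph) → HasGirth G (2 * ℓ)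
    → (∀ k (c : Fin k → Fin (n G)) → IsHole G k c → Even k → ¬ (2 * ℓ + 2 ≤ k))
    → (k : ℕ) (c : Fin k → Fin (n G)) → IsHole G k c → Even k
    → (J₁ J₂ : Jump G k c)
    → (TypeO G k c J₁ ⊎ LocalAcrossOne G k c J₁)
    → (TypeO G k c J₂ ⊎ LocalAcrossOne G k c J₂)
    → ¬ SameEnds G k c J₁ J₂
    → Parallel G k c J₁ J₂
    → InternallyDisjoint G k c J₁ J₂
    → ∃[ x ] ∃[ y ] (Int G k c J₁ x × Int G k c J₂ y × Adj G x y)
lemma4p2 ℓ _ G (_ , girth) noEvenHole k c C k-even J₁ J₂ h₁ h₂ different parallel disjoint
  with interiors-adjacent-or-anticomplete J₁ J₂
... | inj₁ linked = linked
... | inj₂ anticomplete = ⊥-elim (different (Extremal.parallel-jumps-share-ends G k {{k≢0}} c C girth′ noLongEvenHole′ k-even J₁ J₂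
                                              disjoint anticomplete h₁ h₂ parallel))
  where
    k≢0 : NonZero k
    k≢0 = >-nonZero (≤-trans (s≤s z≤n) (proj₁ C))
    k≡2ℓ : k ≡ 2 * ℓ
    k≡2ℓ = even-squeeze (subst Even (*-comm ℓ 2) (m*n%n≡0 ℓ 2)) k-even
             (girth k c (Paths.isHole⇒isCycle G C)) (noEvenHole k c C k-even)
    girth′ : ∀ {L} → Paths.Cycle G L → k ≤ L
    girth′ (w , cycle) = subst (_≤ _) (sym k≡2ℓ) (girth _ w cycle)
    noLongEvenHole′ : ∀ {L} → Paths.Hole G L → Even L → ¬ (k + 2 ≤ L)
    noLongEvenHole′ (w , hole) even = noEvenHole _ w hole even ∘ subst (λ g → g + 2 ≤ _) k≡2ℓ
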